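{- Let $D\ge2$, $N\in\{2D,2D+1\}$, and let $\Gamma$, $V$, $A^{(r)}$, $O$, $\Omega(u,v,w)$ and $\chi_\Omega$ be as in the context. Let $(x,y,0)\in O$ satisfy $|\Omega(x,y,0)|=2N$. Then, with vertex labels taken modulo $N$, \[ A^{(1)}\chi_{\Omega(x,y,0)}=\tfrac{2N}{|\Omega(x-1,y,0)|}\chi_{\Omega(x-1,y,0)}+\tfrac{2N}{|\Omega(x+1,y,0)|}\chi_{\Omega(x+1,y,0)}, \] \[ A^{(2)}\chi_{\Omega(x,y,0)}=\tfrac{2N}{|\Omega(x,y-1,0)|}\chi_{\Omega(x,y-1,0)}+\tfrac{2N}{|\Omega(x,y+1,0)|}\chi_{\Omega(x,y+1,0)}, \] \[ A^{(3)}\chi_{\Omega(x,y,0)}=\tfrac{2N}{|\Omega(x,y,N-1)|}\chi_{\Omega(x,y,N-1)}+\tfrac{2N}{|\Omega(x,y,1)|}\chi_{\Omega(x,y,1)}. \]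
   Context: $\Gamma$ is the cycle graph on $X=\{0,\dots,N-1\}=\mathbb{Z}/N\mathbb{Z}$, with $x\sim y$ iff $x-y\equiv\pm1 \pmod N$; its diameter is $D$. $V$ has basis $X$ and $A_1x=(x-1)+(x+1)$. On $V^{\otimes3}$, $A^{(1)}=A_1\otimes I\otimes I$, $A^{(2)}=I\otimes A_1\otimes I$ and $A^{(3)}=I\otimes I\otimes A_1$. $\operatorname{Aut}(\Gamma)$ (dihedral of order $2N$) acts on $X^3$ diagonally. $\Omega(u,v,w)$ denotes the orbit containing $(u,v,w)$, and $\chi_\Omega=\sum_{(a,b,c)\in\Omega}a\otimes b\otimes c$. The set $O$ of representative triples is defined as follows: - If $N=2D$: $O=\{(x,y,0): 0\le x\le D,\ y\in\{0,D\}\}\cup\{(x,y,0): x\in X,\ 1\le y\le D-1\}$. - If $N=2D+1$: $O=\{(x,0,0): 0\le x\le D\}\cup\{(x,y,0): x\in X,\ 1\le y\le D\}$. -}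

module Defs where

open import Data.Nat using (ℕ; zero; suc; _+_; _*_; _∸_; _≤_; _<_; NonZero)
open import Data.Nat.DivMod using (_%_; _/_; m%n<n)
open import Data.Fin using (Fin; toℕ; fromℕ<; _≟_)
open import Data.Bool using (Bool; true; false; if_then_else_; _∧_)
open import Data.List using (List; map; allFin; tabulate; _++_)
open import Data.Bool.ListAction using (any)
open import Data.Nat.ListAction using (sum)
open import Data.Product using (_×_; _,_)
open import Data.Sum using (_⊎_)
open import Relation.Nullary.Decidable using (⌊_⌋)
open import Relation.Binary.PropositionalEquality using (_≡_)

-- Vertex set X = ℤ/Nℤ, represented by Fin N.
module _ (N : ℕ) .{{_ : NonZero N}} where

  ι : ℕ → Fin N
  ι k = fromℕ< (m%n<n k N)

  suc' : Fin N → Fin N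
  suc' x = ι (toℕ x + 1)

  pred' : Fin N → Fin N
  pred' x = ι (toℕ x + (N ∸ 1))

  zero' one' : Fin N
  zero' = ι 0
  one' = ι 1

  last' : Fin N
  last' = ι (N ∸ 1)

  -- Elements of Aut(Γ) = dihedral group of order 2N:
  -- (false , s) is the rotation x ↦ x + s, (true , s) the reflection x ↦ s - x.
  Dih : Set
  Dih = Bool × Fin N

  dihList : List Dih
  dihList = map (false ,_) (allFin N) ++ map (true ,_) (allFin N)

  act : Dih → Fin N → Fin N
  act (false , s) x = ι (toℕ s + toℕ x)
  act (true  , s) x = ι (toℕ s + (N ∸ toℕ x))

  Triple : Set
  Triple = Fin N × Fin N × Fin N

  act3 : Dih → Triple → Triple
  act3 g (a , b , c) = act g a , act g b , act g c

  eqT : Triple → Triple → Bool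
  eqT (a , b , c) (a' , b' , c') = ⌊ a ≟ a' ⌋ ∧ ⌊ b ≟ b' ⌋ ∧ ⌊ c ≟ c' ⌋

  inOrbit : Triple → Triple → Bool
  inOrbit t t' = any (λ g → eqT (act3 g t) t') dihList

  -- Vectors of V⊗V⊗V in the basis X³ (coefficient functions, integer coefficients)
  Vec3 : Set
  Vec3 = Fin N → Fin N → Fin N → ℕ

  χ : Triple → Vec3
  χ t a b c = if inOrbit t (a , b , c) then 1 else 0

  ΣX : (Fin N → ℕ) → ℕ
  ΣX f = sum (tabulate f)

  orbitSize : Triple → ℕ
  orbitSize t = ΣX (λ a → ΣX (λ b → ΣX (λ c → χ t a b c)))

  -- A^{(1)}, A^{(2)}, A^{(3)} acting on coefficient functions:
  -- A₁ x = (x-1)+(x+1), so the coefficient of y in A₁ v is v(y+1)+v(y-1).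
  A⁽¹⁾ A⁽²⁾ A⁽³⁾ : Vec3 → Vec3
  A⁽¹⁾ f a b c = f (pred' a) b c + f (suc' a) b c
  A⁽²⁾ f a b c = f a (pred' b) c + f a (suc' b) c
  A⁽³⁾ f a b c = f a b (pred' c) + f a b (suc' c)

  lin2 : ℕ → Vec3 → ℕ → Vec3 → Vec3
  lin2 k₁ v₁ k₂ v₂ a b c = k₁ * v₁ a b c + k₂ * v₂ a b c

  inO : ℕ → Fin N → Fin N → Set
  inO D x y =
    (N ≡ 2 * D →
       ((toℕ x ≤ D × (toℕ y ≡ 0 ⊎ toℕ y ≡ D)) ⊎ (1 ≤ toℕ y × toℕ y ≤ D ∸ 1)))
    × (N ≡ 2 * D + 1 →
       ((toℕ x ≤ D × toℕ y ≡ 0) ⊎ (1 ≤ toℕ y × toℕ y ≤ D)))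

-- total natural division (divisor 0 gives 0; never used at 0 since orbits are nonempty)
_div_ : ℕ → ℕ → ℕ
m div zero = 0
m div suc n = m / suc n

-- For t ∈ X³ let ψ_t = ∑_{g ∈ Aut(Γ)} g·t, so that ψ_t(w) counts the automorphisms
-- sending t to w.  Reindexing the sum along g ↦ h ∘ g gives ψ_t(h·t) = ψ_t(t); hence
-- ψ_t = |Stab(t)| χ_{Ω(t)}, and summing over w yields |Stab(t)| · |Ω(t)| = 2N.  In
-- particular ψ_t = χ_{Ω(t)} when |Ω(t)| = 2N.  An automorphism maps the two neighbours
-- of x onto the two neighbours of its image (a rotation keeps them in order, a
-- reflection swaps them), so A⁽¹⁾ψ_(x,y,z) = ψ_(x-1,y,z) + ψ_(x+1,y,z), and likewise
-- for the other two factors; writing each ψ as |Stab| χ gives the three formulas.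

module Submission where

open import Defs
open import Level using (0ℓ)
open import Algebra.Bundles using (AbelianGroup)
import Algebra.Properties.AbelianGroup as AbelianGroupProperties
open import Algebra.Properties.CommutativeSemigroup using (interchange)
open import Data.Nat using (ℕ; zero; suc; _+_; _*_; _∸_; _≤_; _%_; _/_; NonZero; ≢-nonZero⁻¹; >-nonZero⁻¹)
open import Data.Nat.Properties
  using (+-comm; +-assoc; +-identityʳ; *-assoc; *-identityʳ; *-identityˡ; *-zeroʳ; *-cancelʳ-≡; m*n≢0;
         m+[n∸m]≡n; <⇒≤; +-*-semiring; +-commutativeSemigroup)
open import Data.Nat.DivMod using (%-distribˡ-+; m<n⇒m%n≡m; n%n≡0; m*n/n≡m; m%n<n)
open import Algebra.Properties.Semiring.Sum +-*-semiring
  using (sum-syntax; sum-cong-≗; sum-replicate-zero; ∑-distrib-+; ∑-comm; ∑-permute; *-distribˡ-sum)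
open import Data.Fin using (Fin; zero; suc; toℕ; _≟_)
open import Data.Fin.Properties using (toℕ-fromℕ<; toℕ-injective; toℕ<n)
open import Data.Fin.Permutation using (permutation)
open import Data.Bool using (Bool; true; false; T; _∧_; _xor_; if_then_else_)
open import Data.Bool.Properties using (T-∧)
open import Data.Unit using (tt)
open import Data.Product using (_×_; _,_; ∃)
open import Data.Sum using (_⊎_)
open import Data.List using (map; allFin; tabulate)
open import Data.Nat.ListAction using () renaming (sum to listSum)
open import Data.List.Membership.Propositional using (_∈_; lose)
open import Data.List.Membership.Propositional.Properties using (∈-map⁺; ∈-++⁺ˡ; ∈-++⁺ʳ; ∈-allFin)
open import Data.List.Relation.Unary.Any using (satisfied)
open import Data.List.Relation.Unary.Any.Properties using (any⁺; any⁻)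
open import Function using (_∘_; Equivalence; mk⇔; _⇔_)
open import Relation.Nullary using (¬_; yes; no; contradiction)
open import Relation.Nullary.Decidable using (Dec; ⌊_⌋; ⌊⌋-map′; isYes≗does; does-⇔; T?)
open import Relation.Binary.PropositionalEquality
  using (_≡_; refl; sym; trans; cong; cong₂; isEquivalence; module ≡-Reasoning)

𝟙 : Bool → ℕ
𝟙 b = if b then 1 else 0

𝟙-T : ∀ {b} → T b → 𝟙 b ≡ 1
𝟙-T {true} _ = refl

𝟙-¬T : ∀ {b} → ¬ T b → 𝟙 b ≡ 0
𝟙-¬T {true} ¬b = contradiction tt ¬b
𝟙-¬T {false} _ = refl

𝟙-∧ : ∀ p q → 𝟙 (p ∧ q) ≡ 𝟙 p * 𝟙 q
𝟙-∧ true q = sym (+-identityʳ (𝟙 q))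
𝟙-∧ false q = refl

⌊⌋-⇔ : ∀ {a b} {A : Set a} {B : Set b} → A ⇔ B → (a? : Dec A) (b? : Dec B) → ⌊ a? ⌋ ≡ ⌊ b? ⌋
⌊⌋-⇔ A⇔B a? b? = trans (isYes≗does a?) (trans (does-⇔ A⇔B a? b?) (sym (isYes≗does b?)))

≟-sound : ∀ {n} {x y : Fin n} → T ⌊ x ≟ y ⌋ → x ≡ y
≟-sound {x = x} {y} h with x ≟ y
... | yes x≡y = x≡y

sum-tabulate : ∀ {n} (f : Fin n → ℕ) → listSum (tabulate f) ≡ ∑[ i < n ] f i
sum-tabulate {zero} f = refl
sum-tabulate {suc n} f = cong (f zero +_) (sum-tabulate (f ∘ suc))

∑-const-1 : ∀ n → ∑[ i < n ] 1 ≡ n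
∑-const-1 zero = refl
∑-const-1 (suc n) = cong suc (∑-const-1 n)

∑-𝟙≟ : ∀ {n} (u : Fin n) → ∑[ i < n ] 𝟙 ⌊ u ≟ i ⌋ ≡ 1
∑-𝟙≟ {suc n} zero = cong suc (sum-replicate-zero n)
∑-𝟙≟ {suc n} (suc u) = trans (sum-cong-≗ (λ i → cong 𝟙 (⌊⌋-map′ _ _ (u ≟ i)))) (∑-𝟙≟ u)

∑-*𝟙≟ : ∀ {n} (u : Fin n) k → ∑[ i < n ] (k * 𝟙 ⌊ u ≟ i ⌋) ≡ k
∑-*𝟙≟ u k =
  trans (sym (*-distribˡ-sum k (λ i → 𝟙 ⌊ u ≟ i ⌋))) (trans (cong (k *_) (∑-𝟙≟ u)) (*-identityʳ k))

div-exact : ∀ k m n .{{_ : NonZero n}} → k * m ≡ n → n div m ≡ k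
div-exact k zero n e = contradiction (trans (sym e) (*-zeroʳ k)) (≢-nonZero⁻¹ n)
div-exact k (suc m) n e = trans (cong (_/ suc m) (sym e)) (m*n/n≡m k (suc m))

module _ (N : ℕ) .{{_ : NonZero N}} where

  open ≡-Reasoning

  -- ℤ/N on Fin N

  infixl 6 _⊕_
  _⊕_ : Fin N → Fin N → Fin N
  a ⊕ b = ι N (toℕ a + toℕ b)

  ⊖_ : Fin N → Fin N
  ⊖ a = ι N (N ∸ toℕ a)

  toℕ-ι : ∀ k → toℕ (ι N k) ≡ k % N
  toℕ-ι k = toℕ-fromℕ< (m%n<n k N)

  ι-toℕ : ∀ x → ι N (toℕ x) ≡ x
  ι-toℕ x = toℕ-injective (trans (toℕ-ι (toℕ x)) (m<n⇒m%n≡m (toℕ<n x)))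

  ι-+ : ∀ m n → ι N (m + n) ≡ ι N m ⊕ ι N n
  ι-+ m n = toℕ-injective (begin
    toℕ (ι N (m + n))                ≡⟨ toℕ-ι (m + n) ⟩
    (m + n) % N                      ≡⟨ %-distribˡ-+ m n N ⟩
    (m % N + n % N) % N              ≡⟨ cong₂ (λ u v → (u + v) % N) (toℕ-ι m) (toℕ-ι n) ⟨
    (toℕ (ι N m) + toℕ (ι N n)) % N  ≡⟨ toℕ-ι _ ⟨
    toℕ (ι N m ⊕ ι N n)              ∎)

  ι-N : ι N N ≡ zero' N
  ι-N = toℕ-injective (begin
    toℕ (ι N N)  ≡⟨ toℕ-ι N ⟩
    N % N        ≡⟨ n%n≡0 N ⟩
    0            ≡⟨ m<n⇒m%n≡m (>-nonZero⁻¹ N) ⟨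
    0 % N        ≡⟨ toℕ-ι 0 ⟨
    toℕ (ι N 0)  ∎)

  ⊕-comm : ∀ a b → a ⊕ b ≡ b ⊕ a
  ⊕-comm a b = cong (ι N) (+-comm (toℕ a) (toℕ b))

  ⊕-assoc : ∀ a b c → (a ⊕ b) ⊕ c ≡ a ⊕ (b ⊕ c)
  ⊕-assoc a b c = begin
    ι N (toℕ a + toℕ b) ⊕ c            ≡⟨ cong (ι N (toℕ a + toℕ b) ⊕_) (ι-toℕ c) ⟨
    ι N (toℕ a + toℕ b) ⊕ ι N (toℕ c)  ≡⟨ ι-+ _ _ ⟨
    ι N (toℕ a + toℕ b + toℕ c)        ≡⟨ cong (ι N) (+-assoc (toℕ a) _ _) ⟩
    ι N (toℕ a + (toℕ b + toℕ c))      ≡⟨ ι-+ _ _ ⟩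
    ι N (toℕ a) ⊕ (b ⊕ c)              ≡⟨ cong (_⊕ (b ⊕ c)) (ι-toℕ a) ⟩
    a ⊕ (b ⊕ c)                        ∎

  ⊕-identityˡ : ∀ a → zero' N ⊕ a ≡ a
  ⊕-identityˡ a = begin
    zero' N ⊕ a            ≡⟨ cong (zero' N ⊕_) (ι-toℕ a) ⟨
    zero' N ⊕ ι N (toℕ a)  ≡⟨ ι-+ 0 (toℕ a) ⟨
    ι N (toℕ a)            ≡⟨ ι-toℕ a ⟩
    a                      ∎

  ⊖-inverseʳ : ∀ a → a ⊕ ⊖ a ≡ zero' N
  ⊖-inverseʳ a = begin
    a ⊕ ⊖ a                          ≡⟨ cong (_⊕ ⊖ a) (ι-toℕ a) ⟨
    ι N (toℕ a) ⊕ ⊖ a                ≡⟨ ι-+ (toℕ a) _ ⟨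
    ι N (toℕ a + (N ∸ toℕ a))        ≡⟨ cong (ι N) (m+[n∸m]≡n (<⇒≤ (toℕ<n a))) ⟩
    ι N N                            ≡⟨ ι-N ⟩
    zero' N                          ∎

  ℤ/N : AbelianGroup 0ℓ 0ℓ
  ℤ/N = record
    { Carrier = Fin N
    ; _≈_ = _≡_
    ; _∙_ = _⊕_
    ; ε = zero' N
    ; _⁻¹ = ⊖_
    ; isAbelianGroup = record
      { isGroup = record
        { isMonoid = record
          { isSemigroup = record
            { isMagma = record { isEquivalence = isEquivalence ; ∙-cong = cong₂ _⊕_ }
            ; assoc = ⊕-assoc
            }
          ; identity = ⊕-identityˡ , λ a → trans (⊕-comm a _) (⊕-identityˡ a)
          }
        ; inverse = (λ a → trans (⊕-comm _ a) (⊖-inverseʳ a)) , ⊖-inverseʳ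
        ; ⁻¹-cong = cong ⊖_
        }
      ; comm = ⊕-comm
      }
    }

  open AbelianGroupProperties ℤ/N
    using (⁻¹-involutive; ⁻¹-∙-comm; ⁻¹-injective; ∙-cancelˡ; inverseʳ-unique; x≈z//y;
           //-rightDividesˡ; //-rightDividesʳ; \\-leftDividesˡ; \\-leftDividesʳ)

  suc'≡⊕one' : ∀ x → suc' N x ≡ x ⊕ one' N
  suc'≡⊕one' x = trans (ι-+ (toℕ x) 1) (cong (_⊕ one' N) (ι-toℕ x))

  last'≡⊖one' : last' N ≡ ⊖ one' N
  last'≡⊖one' = inverseʳ-unique (one' N) (last' N) (begin
    ι N 1 ⊕ ι N (N ∸ 1)  ≡⟨ ι-+ 1 (N ∸ 1) ⟨
    ι N (1 + (N ∸ 1))    ≡⟨ cong (ι N) (m+[n∸m]≡n (>-nonZero⁻¹ N)) ⟩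
    ι N N                ≡⟨ ι-N ⟩
    zero' N              ∎)

  pred'≡⊕last' : ∀ x → pred' N x ≡ x ⊕ last' N
  pred'≡⊕last' x = trans (ι-+ (toℕ x) (N ∸ 1)) (cong (_⊕ last' N) (ι-toℕ x))

  pred'≡⊕⊖one' : ∀ x → pred' N x ≡ x ⊕ ⊖ one' N
  pred'≡⊕⊖one' x = trans (pred'≡⊕last' x) (cong (x ⊕_) last'≡⊖one')

  pred'-zero' : pred' N (zero' N) ≡ last' N
  pred'-zero' = trans (pred'≡⊕last' (zero' N)) (⊕-identityˡ (last' N))

  suc'-zero' : suc' N (zero' N) ≡ one' N
  suc'-zero' = trans (suc'≡⊕one' (zero' N)) (⊕-identityˡ (one' N))

  -- The dihedral group Aut(Γ)

  sgn : Bool → Fin N → Fin N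
  sgn false x = x
  sgn true x = ⊖ x

  sgn-⊕ : ∀ p a b → sgn p (a ⊕ b) ≡ sgn p a ⊕ sgn p b
  sgn-⊕ false a b = refl
  sgn-⊕ true a b = sym (⁻¹-∙-comm a b)

  sgn-sgn : ∀ p q x → sgn p (sgn q x) ≡ sgn (p xor q) x
  sgn-sgn false q x = refl
  sgn-sgn true false x = refl
  sgn-sgn true true x = ⁻¹-involutive x

  sgn-injective : ∀ p {x y} → sgn p x ≡ sgn p y → x ≡ y
  sgn-injective false e = e
  sgn-injective true e = ⁻¹-injective e

  act≡⊕sgn : ∀ p s x → act N (p , s) x ≡ s ⊕ sgn p x
  act≡⊕sgn false s x = refl
  act≡⊕sgn true s x = trans (ι-+ (toℕ s) (N ∸ toℕ x)) (cong (_⊕ ⊖ x) (ι-toℕ s))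

  act-⊕ : ∀ p s x k → act N (p , s) (x ⊕ k) ≡ act N (p , s) x ⊕ sgn p k
  act-⊕ p s x k = begin
    act N (p , s) (x ⊕ k)        ≡⟨ act≡⊕sgn p s (x ⊕ k) ⟩
    s ⊕ sgn p (x ⊕ k)            ≡⟨ cong (s ⊕_) (sgn-⊕ p x k) ⟩
    s ⊕ (sgn p x ⊕ sgn p k)      ≡⟨ ⊕-assoc s _ _ ⟨
    s ⊕ sgn p x ⊕ sgn p k        ≡⟨ cong (_⊕ sgn p k) (act≡⊕sgn p s x) ⟨
    act N (p , s) x ⊕ sgn p k    ∎

  act-injective : ∀ g {x y} → act N g x ≡ act N g y → x ≡ y
  act-injective (p , s) {x} {y} e =
    sgn-injective p (∙-cancelˡ s _ _ (trans (sym (act≡⊕sgn p s x)) (trans e (act≡⊕sgn p s y))))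

  -- (p , s) acts as x ↦ s ⊕ sgn p x (act≡⊕sgn), which dictates the composition law.
  infixr 9 _∘ᴰ_
  _∘ᴰ_ : Dih N → Dih N → Dih N
  (p , s) ∘ᴰ (q , r) = p xor q , act N (p , s) r

  act-∘ᴰ : ∀ g h x → act N (g ∘ᴰ h) x ≡ act N g (act N h x)
  act-∘ᴰ (p , s) (q , r) x = begin
    act N (p xor q , act N (p , s) r) x  ≡⟨ act≡⊕sgn (p xor q) _ x ⟩
    act N (p , s) r ⊕ sgn (p xor q) x    ≡⟨ cong₂ _⊕_ (act≡⊕sgn p s r) (sym (sgn-sgn p q x)) ⟩
    s ⊕ sgn p r ⊕ sgn p (sgn q x)        ≡⟨ ⊕-assoc s _ _ ⟩
    s ⊕ (sgn p r ⊕ sgn p (sgn q x))      ≡⟨ cong (s ⊕_) (sgn-⊕ p r (sgn q x)) ⟨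
    s ⊕ sgn p (r ⊕ sgn q x)              ≡⟨ cong (λ y → s ⊕ sgn p y) (act≡⊕sgn q r x) ⟨
    s ⊕ sgn p (act N (q , r) x)          ≡⟨ act≡⊕sgn p s _ ⟨
    act N (p , s) (act N (q , r) x)      ∎

  _⁻¹ᴰ : Dih N → Dih N
  (false , s) ⁻¹ᴰ = false , ⊖ s
  (true , s) ⁻¹ᴰ = true , s

  reflection-involutive : ∀ s x → act N (true , s) (act N (true , s) x) ≡ x
  reflection-involutive s x = begin
    act N (true , s) (act N (true , s) x)  ≡⟨ act-∘ᴰ (true , s) (true , s) x ⟨
    act N (true , s) s ⊕ x                 ≡⟨ cong (_⊕ x) (trans (act≡⊕sgn true s s) (⊖-inverseʳ s)) ⟩
    zero' N ⊕ x                            ≡⟨ ⊕-identityˡ x ⟩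
    x                                      ∎

  act-⁻¹ᴰ-inverseˡ : ∀ g x → act N g (act N (g ⁻¹ᴰ) x) ≡ x
  act-⁻¹ᴰ-inverseˡ (false , s) x = \\-leftDividesˡ s x
  act-⁻¹ᴰ-inverseˡ (true , s) x = reflection-involutive s x

  act-⁻¹ᴰ-inverseʳ : ∀ g x → act N (g ⁻¹ᴰ) (act N g x) ≡ x
  act-⁻¹ᴰ-inverseʳ (false , s) x = \\-leftDividesʳ s x
  act-⁻¹ᴰ-inverseʳ (true , s) x = reflection-involutive s x

  ∑-act : ∀ g (f : Fin N → ℕ) → ∑[ s < N ] f (act N g s) ≡ ∑[ s < N ] f s
  ∑-act g f =
    sym (∑-permute f (permutation (act N g) (act N (g ⁻¹ᴰ)) (act-⁻¹ᴰ-inverseˡ g) (act-⁻¹ᴰ-inverseʳ g)))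

  ∑ᴰ : (Dih N → ℕ) → ℕ
  ∑ᴰ f = ∑[ s < N ] f (false , s) + ∑[ s < N ] f (true , s)

  ∑ᴰ-cong : ∀ {f f′} → (∀ g → f g ≡ f′ g) → ∑ᴰ f ≡ ∑ᴰ f′
  ∑ᴰ-cong e = cong₂ _+_ (sum-cong-≗ (λ s → e (false , s))) (sum-cong-≗ (λ s → e (true , s)))

  ∑ᴰ-distrib-+ : ∀ f f′ → ∑ᴰ (λ g → f g + f′ g) ≡ ∑ᴰ f + ∑ᴰ f′
  ∑ᴰ-distrib-+ f f′ = trans
    (cong₂ _+_ (∑-distrib-+ (λ s → f (false , s)) _) (∑-distrib-+ (λ s → f (true , s)) _))
    (interchange +-commutativeSemigroup (∑[ s < N ] f (false , s)) (∑[ s < N ] f′ (false , s)) _ _)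

  ∑ᴰ-const-1 : ∑ᴰ (λ _ → 1) ≡ 2 * N
  ∑ᴰ-const-1 = trans (cong₂ _+_ (∑-const-1 N) (∑-const-1 N)) (cong (N +_) (sym (+-identityʳ N)))

  ∑ᴰ-∘ᴰ : ∀ h f → ∑ᴰ (λ g → f (h ∘ᴰ g)) ≡ ∑ᴰ f
  ∑ᴰ-∘ᴰ h@(false , _) f = cong₂ _+_ (∑-act h (λ s → f (false , s))) (∑-act h (λ s → f (true , s)))
  ∑ᴰ-∘ᴰ h@(true , _) f =
    trans (cong₂ _+_ (∑-act h (λ s → f (true , s))) (∑-act h (λ s → f (false , s))))
          (+-comm (∑[ s < N ] f (true , s)) _)

  ∑-∑ᴰ-comm : ∀ {n} (F : Fin n → Dih N → ℕ) → ∑[ i < n ] ∑ᴰ (F i) ≡ ∑ᴰ (λ g → ∑[ i < n ] F i g)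
  ∑-∑ᴰ-comm F = trans (∑-distrib-+ (λ i → ∑[ s < N ] F i (false , s)) _)
    (cong₂ _+_ (∑-comm (λ i s → F i (false , s))) (∑-comm (λ i s → F i (true , s))))

  ∑³ : (Triple N → ℕ) → ℕ
  ∑³ f = ∑[ a < N ] ∑[ b < N ] ∑[ c < N ] f (a , b , c)

  ∑³-cong : ∀ {f f′} → (∀ w → f w ≡ f′ w) → ∑³ f ≡ ∑³ f′
  ∑³-cong e = sum-cong-≗ (λ a → sum-cong-≗ (λ b → sum-cong-≗ (λ c → e (a , b , c))))

  ∑³-*-distribˡ : ∀ k f → ∑³ (λ w → k * f w) ≡ k * ∑³ f
  ∑³-*-distribˡ k f = sym (trans (*-distribˡ-sum k (λ a → ∑[ b < N ] ∑[ c < N ] f (a , b , c)))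
    (sum-cong-≗ (λ a → trans (*-distribˡ-sum k (λ b → ∑[ c < N ] f (a , b , c)))
      (sum-cong-≗ (λ b → *-distribˡ-sum k (λ c → f (a , b , c)))))))

  ∑³-∑ᴰ-comm : ∀ (F : Triple N → Dih N → ℕ) → ∑³ (λ w → ∑ᴰ (F w)) ≡ ∑ᴰ (λ g → ∑³ (λ w → F w g))
  ∑³-∑ᴰ-comm F = trans
    (sum-cong-≗ (λ a → trans (sum-cong-≗ (λ b → ∑-∑ᴰ-comm (λ c → F (a , b , c))))
                              (∑-∑ᴰ-comm (λ b g → ∑[ c < N ] F (a , b , c) g))))
    (∑-∑ᴰ-comm (λ a g → ∑[ b < N ] ∑[ c < N ] F (a , b , c) g))

  ∑³-eqT : ∀ u → ∑³ (𝟙 ∘ eqT N u) ≡ 1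
  ∑³-eqT (u₁ , u₂ , u₃) = begin
    ∑³ (𝟙 ∘ eqT N (u₁ , u₂ , u₃))
      ≡⟨ sum-cong-≗ (λ a → sum-cong-≗ (λ b → sum-cong-≗ (factor a b))) ⟩
    ∑[ a < N ] ∑[ b < N ] ∑[ c < N ] (δ u₁ a * δ u₂ b * δ u₃ c)
      ≡⟨ sum-cong-≗ (λ a → sum-cong-≗ (λ b → ∑-*𝟙≟ u₃ (δ u₁ a * δ u₂ b))) ⟩
    ∑[ a < N ] ∑[ b < N ] (δ u₁ a * δ u₂ b)
      ≡⟨ sum-cong-≗ (λ a → ∑-*𝟙≟ u₂ (δ u₁ a)) ⟩
    ∑[ a < N ] δ u₁ a
      ≡⟨ ∑-𝟙≟ u₁ ⟩
    1 ∎
    where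
    δ : Fin N → Fin N → ℕ
    δ u v = 𝟙 ⌊ u ≟ v ⌋
    factor : ∀ a b c → 𝟙 (eqT N (u₁ , u₂ , u₃) (a , b , c)) ≡ δ u₁ a * δ u₂ b * δ u₃ c
    factor a b c = trans (𝟙-∧ ⌊ u₁ ≟ a ⌋ (⌊ u₂ ≟ b ⌋ ∧ ⌊ u₃ ≟ c ⌋))
      (trans (cong (δ u₁ a *_) (𝟙-∧ ⌊ u₂ ≟ b ⌋ ⌊ u₃ ≟ c ⌋)) (sym (*-assoc (δ u₁ a) (δ u₂ b) (δ u₃ c))))

  orbitSize≡∑³ : ∀ t → orbitSize N t ≡ ∑³ (λ w → 𝟙 (inOrbit N t w))
  orbitSize≡∑³ t =
    trans (sum-tabulate (λ a → ΣX N (λ b → ΣX N (χ N t a b))))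
      (sum-cong-≗ (λ a → trans (sum-tabulate (λ b → ΣX N (χ N t a b)))
        (sum-cong-≗ (λ b → sum-tabulate (χ N t a b)))))

  -- Orbits and orbit sums

  ⌊act≟act⌋ : ∀ g x y → ⌊ act N g x ≟ act N g y ⌋ ≡ ⌊ x ≟ y ⌋
  ⌊act≟act⌋ g x y = ⌊⌋-⇔ (mk⇔ (act-injective g) (cong (act N g))) _ _

  eqT-act3 : ∀ g u v → eqT N (act3 N g u) (act3 N g v) ≡ eqT N u v
  eqT-act3 g (a , b , c) (a′ , b′ , c′) =
    cong₂ _∧_ (⌊act≟act⌋ g a a′) (cong₂ _∧_ (⌊act≟act⌋ g b b′) (⌊act≟act⌋ g c c′))

  eqT-sound : ∀ u v → T (eqT N u v) → u ≡ v
  eqT-sound (a , b , c) (a′ , b′ , c′) h =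
    let (a≡a′ , h′) = Equivalence.to T-∧ h
        (b≡b′ , c≡c′) = Equivalence.to T-∧ h′
    in cong₂ _,_ (≟-sound a≡a′) (cong₂ _,_ (≟-sound b≡b′) (≟-sound c≡c′))

  act3-∘ᴰ : ∀ g h t → act3 N (g ∘ᴰ h) t ≡ act3 N g (act3 N h t)
  act3-∘ᴰ g h (a , b , c) = cong₂ _,_ (act-∘ᴰ g h a) (cong₂ _,_ (act-∘ᴰ g h b) (act-∘ᴰ g h c))

  ∈-dihList : ∀ g → g ∈ dihList N
  ∈-dihList (false , s) = ∈-++⁺ˡ (∈-map⁺ (false ,_) (∈-allFin s))
  ∈-dihList (true , s) = ∈-++⁺ʳ (map (false ,_) (allFin N)) (∈-map⁺ (true ,_) (∈-allFin s))

  inOrbit-intro : ∀ t w g → T (eqT N (act3 N g t) w) → T (inOrbit N t w)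
  inOrbit-intro t w g e = any⁺ _ (lose (∈-dihList g) e)

  inOrbit-elim : ∀ t w → T (inOrbit N t w) → ∃ λ h → act3 N h t ≡ w
  inOrbit-elim t w w∈Ωt =
    let (h , e) = satisfied (any⁻ _ (dihList N) w∈Ωt) in h , eqT-sound _ _ e

  -- The w-coefficient of ψ_t = ∑_{g ∈ Aut(Γ)} g·t.
  orbitSum : Triple N → Triple N → ℕ
  orbitSum t w = ∑ᴰ (λ g → 𝟙 (eqT N (act3 N g t) w))

  orbitSum-act3 : ∀ h t → orbitSum t (act3 N h t) ≡ orbitSum t t
  orbitSum-act3 h t = begin
    ∑ᴰ (λ g → 𝟙 (eqT N (act3 N g t) (act3 N h t)))
      ≡⟨ ∑ᴰ-∘ᴰ h (λ g → 𝟙 (eqT N (act3 N g t) (act3 N h t))) ⟨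
    ∑ᴰ (λ g → 𝟙 (eqT N (act3 N (h ∘ᴰ g) t) (act3 N h t)))
      ≡⟨ ∑ᴰ-cong (cong 𝟙 ∘ translate) ⟩
    ∑ᴰ (λ g → 𝟙 (eqT N (act3 N g t) t)) ∎
    where
    translate : ∀ g → eqT N (act3 N (h ∘ᴰ g) t) (act3 N h t) ≡ eqT N (act3 N g t) t
    translate g = trans (cong (λ u → eqT N u (act3 N h t)) (act3-∘ᴰ h g t)) (eqT-act3 h (act3 N g t) t)

  orbitSum-outside : ∀ t w → ¬ T (inOrbit N t w) → orbitSum t w ≡ 0
  orbitSum-outside t w w∉Ωt =
    trans (∑ᴰ-cong (λ g → 𝟙-¬T (w∉Ωt ∘ inOrbit-intro t w g)))
          (cong₂ _+_ (sum-replicate-zero N) (sum-replicate-zero N))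

  orbitSum-stabiliser : ∀ t w → orbitSum t w ≡ orbitSum t t * 𝟙 (inOrbit N t w)
  orbitSum-stabiliser t w with T? (inOrbit N t w)
  ... | yes w∈Ωt = let (h , ht≡w) = inOrbit-elim t w w∈Ωt in begin
    orbitSum t w                          ≡⟨ cong (orbitSum t) ht≡w ⟨
    orbitSum t (act3 N h t)               ≡⟨ orbitSum-act3 h t ⟩
    orbitSum t t                          ≡⟨ *-identityʳ (orbitSum t t) ⟨
    orbitSum t t * 1                      ≡⟨ cong (orbitSum t t *_) (𝟙-T w∈Ωt) ⟨
    orbitSum t t * 𝟙 (inOrbit N t w)      ∎
  ... | no w∉Ωt = begin
    orbitSum t w                          ≡⟨ orbitSum-outside t w w∉Ωt ⟩
    0                                     ≡⟨ *-zeroʳ (orbitSum t t) ⟨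
    orbitSum t t * 0                      ≡⟨ cong (orbitSum t t *_) (𝟙-¬T w∉Ωt) ⟨
    orbitSum t t * 𝟙 (inOrbit N t w)      ∎

  orbit-stabiliser : ∀ t → orbitSum t t * orbitSize N t ≡ 2 * N
  orbit-stabiliser t = begin
    orbitSum t t * orbitSize N t                      ≡⟨ cong (orbitSum t t *_) (orbitSize≡∑³ t) ⟩
    orbitSum t t * ∑³ (λ w → 𝟙 (inOrbit N t w))       ≡⟨ ∑³-*-distribˡ (orbitSum t t) _ ⟨
    ∑³ (λ w → orbitSum t t * 𝟙 (inOrbit N t w))       ≡⟨ ∑³-cong (orbitSum-stabiliser t) ⟨
    ∑³ (orbitSum t)                                   ≡⟨ ∑³-∑ᴰ-comm (λ w g → 𝟙 (eqT N (act3 N g t) w)) ⟩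
    ∑ᴰ (λ g → ∑³ (𝟙 ∘ eqT N (act3 N g t)))            ≡⟨ ∑ᴰ-cong (λ g → ∑³-eqT (act3 N g t)) ⟩
    ∑ᴰ (λ _ → 1)                                      ≡⟨ ∑ᴰ-const-1 ⟩
    2 * N                                             ∎

  stabiliser-size : ∀ t → (2 * N) div orbitSize N t ≡ orbitSum t t
  stabiliser-size t = div-exact (orbitSum t t) (orbitSize N t) (2 * N) {{m*n≢0 2 N}} (orbit-stabiliser t)

  orbitSum≡div*χ : ∀ t w → orbitSum t w ≡ (2 * N) div orbitSize N t * 𝟙 (inOrbit N t w)
  orbitSum≡div*χ t w = trans (orbitSum-stabiliser t w) (cong (_* 𝟙 (inOrbit N t w)) (sym (stabiliser-size t)))

  regular⇒χ≡orbitSum : ∀ {t} → orbitSize N t ≡ 2 * N → ∀ w → 𝟙 (inOrbit N t w) ≡ orbitSum t w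
  regular⇒χ≡orbitSum {t} regular w = begin
    𝟙 (inOrbit N t w)                  ≡⟨ *-identityˡ _ ⟨
    1 * 𝟙 (inOrbit N t w)              ≡⟨ cong (_* 𝟙 (inOrbit N t w)) trivial-stabiliser ⟨
    orbitSum t t * 𝟙 (inOrbit N t w)   ≡⟨ orbitSum-stabiliser t w ⟨
    orbitSum t w                       ∎
    where
    trivial-stabiliser : orbitSum t t ≡ 1
    trivial-stabiliser = *-cancelʳ-≡ (orbitSum t t) 1 (2 * N) {{m*n≢0 2 N}}
      (trans (trans (cong (orbitSum t t *_) (sym regular)) (orbit-stabiliser t)) (sym (*-identityˡ (2 * N))))

  -- Adjacency

  ≡⊕⊖⇔⊕≡ : ∀ u a k → (u ≡ a ⊕ ⊖ k) ⇔ (u ⊕ k ≡ a)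
  ≡⊕⊖⇔⊕≡ u a k = mk⇔ (λ e → trans (cong (_⊕ k) e) (//-rightDividesˡ k a)) (x≈z//y u k a)

  ≡⊕⇔⊕⊖≡ : ∀ u a k → (u ≡ a ⊕ k) ⇔ (u ⊕ ⊖ k ≡ a)
  ≡⊕⇔⊕⊖≡ u a k = mk⇔ (λ e → trans (cong (_⊕ ⊖ k) e) (//-rightDividesʳ k a))
                      (λ e → trans (sym (//-rightDividesˡ k u)) (cong (_⊕ k) e))

  ⌊≟pred'⌋ : ∀ u a → ⌊ u ≟ pred' N a ⌋ ≡ ⌊ suc' N u ≟ a ⌋
  ⌊≟pred'⌋ u a rewrite pred'≡⊕⊖one' a | suc'≡⊕one' u = ⌊⌋-⇔ (≡⊕⊖⇔⊕≡ u a (one' N)) _ _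

  ⌊≟suc'⌋ : ∀ u a → ⌊ u ≟ suc' N a ⌋ ≡ ⌊ pred' N u ≟ a ⌋
  ⌊≟suc'⌋ u a rewrite suc'≡⊕one' a | pred'≡⊕⊖one' u = ⌊⌋-⇔ (≡⊕⇔⊕⊖≡ u a (one' N)) _ _

  act-pred' : ∀ p s x → act N (p , s) (pred' N x) ≡ act N (p , s) x ⊕ sgn p (⊖ one' N)
  act-pred' p s x = trans (cong (act N (p , s)) (pred'≡⊕⊖one' x)) (act-⊕ p s x (⊖ one' N))

  act-suc' : ∀ p s x → act N (p , s) (suc' N x) ≡ act N (p , s) x ⊕ sgn p (one' N)
  act-suc' p s x = trans (cong (act N (p , s)) (suc'≡⊕one' x)) (act-⊕ p s x (one' N))

  act-neighbours : ∀ g x (F : Fin N → ℕ) →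
    F (act N g (pred' N x)) + F (act N g (suc' N x)) ≡ F (pred' N (act N g x)) + F (suc' N (act N g x))
  act-neighbours (false , s) x F = cong₂ (λ u v → F u + F v)
    (trans (act-pred' false s x) (sym (pred'≡⊕⊖one' _)))
    (trans (act-suc' false s x) (sym (suc'≡⊕one' _)))
  act-neighbours (true , s) x F = trans
    (cong₂ (λ u v → F u + F v)
      (trans (act-pred' true s x)
        (trans (cong (act N (true , s) x ⊕_) (⁻¹-involutive (one' N))) (sym (suc'≡⊕one' _))))
      (trans (act-suc' true s x) (sym (pred'≡⊕⊖one' _))))
    (+-comm (F (suc' N (act N (true , s) x))) _)

  ≟-neighbours : ∀ g x a (φ : Bool → ℕ) →
    φ ⌊ act N g x ≟ pred' N a ⌋ + φ ⌊ act N g x ≟ suc' N a ⌋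
      ≡ φ ⌊ act N g (pred' N x) ≟ a ⌋ + φ ⌊ act N g (suc' N x) ≟ a ⌋
  ≟-neighbours g x a φ = begin
    φ ⌊ gx ≟ pred' N a ⌋ + φ ⌊ gx ≟ suc' N a ⌋
      ≡⟨ cong₂ (λ p q → φ p + φ q) (⌊≟pred'⌋ gx a) (⌊≟suc'⌋ gx a) ⟩
    φ ⌊ suc' N gx ≟ a ⌋ + φ ⌊ pred' N gx ≟ a ⌋
      ≡⟨ +-comm (φ ⌊ suc' N gx ≟ a ⌋) _ ⟩
    φ ⌊ pred' N gx ≟ a ⌋ + φ ⌊ suc' N gx ≟ a ⌋
      ≡⟨ act-neighbours g x (λ u → φ ⌊ u ≟ a ⌋) ⟨
    φ ⌊ act N g (pred' N x) ≟ a ⌋ + φ ⌊ act N g (suc' N x) ≟ a ⌋ ∎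
    where
    gx : Fin N
    gx = act N g x

  orbitSum-neighbours : ∀ {t t₋ t₊ w₋ w₊ w} →
    (∀ g → 𝟙 (eqT N (act3 N g t) w₋) + 𝟙 (eqT N (act3 N g t) w₊)
             ≡ 𝟙 (eqT N (act3 N g t₋) w) + 𝟙 (eqT N (act3 N g t₊) w)) →
    orbitSum t w₋ + orbitSum t w₊ ≡ orbitSum t₋ w + orbitSum t₊ w
  orbitSum-neighbours {t} {t₋} {t₊} {w₋} {w₊} {w} h = begin
    orbitSum t w₋ + orbitSum t w₊
      ≡⟨ ∑ᴰ-distrib-+ (λ g → 𝟙 (eqT N (act3 N g t) w₋)) (λ g → 𝟙 (eqT N (act3 N g t) w₊)) ⟨
    ∑ᴰ (λ g → 𝟙 (eqT N (act3 N g t) w₋) + 𝟙 (eqT N (act3 N g t) w₊))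
      ≡⟨ ∑ᴰ-cong h ⟩
    ∑ᴰ (λ g → 𝟙 (eqT N (act3 N g t₋) w) + 𝟙 (eqT N (act3 N g t₊) w))
      ≡⟨ ∑ᴰ-distrib-+ (λ g → 𝟙 (eqT N (act3 N g t₋) w)) (λ g → 𝟙 (eqT N (act3 N g t₊) w)) ⟩
    orbitSum t₋ w + orbitSum t₊ w ∎

  A⁽¹⁾-orbitSum : ∀ x y z a b c →
    orbitSum (x , y , z) (pred' N a , b , c) + orbitSum (x , y , z) (suc' N a , b , c)
      ≡ orbitSum (pred' N x , y , z) (a , b , c) + orbitSum (suc' N x , y , z) (a , b , c)
  A⁽¹⁾-orbitSum x y z a b c = orbitSum-neighbours λ g →
    ≟-neighbours g x a (λ p → 𝟙 (p ∧ ⌊ act N g y ≟ b ⌋ ∧ ⌊ act N g z ≟ c ⌋))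

  A⁽²⁾-orbitSum : ∀ x y z a b c →
    orbitSum (x , y , z) (a , pred' N b , c) + orbitSum (x , y , z) (a , suc' N b , c)
      ≡ orbitSum (x , pred' N y , z) (a , b , c) + orbitSum (x , suc' N y , z) (a , b , c)
  A⁽²⁾-orbitSum x y z a b c = orbitSum-neighbours λ g →
    ≟-neighbours g y b (λ p → 𝟙 (⌊ act N g x ≟ a ⌋ ∧ p ∧ ⌊ act N g z ≟ c ⌋))

  A⁽³⁾-orbitSum : ∀ x y z a b c →
    orbitSum (x , y , z) (a , b , pred' N c) + orbitSum (x , y , z) (a , b , suc' N c)
      ≡ orbitSum (x , y , pred' N z) (a , b , c) + orbitSum (x , y , suc' N z) (a , b , c)
  A⁽³⁾-orbitSum x y z a b c = orbitSum-neighbours λ g →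
    ≟-neighbours g z c (λ p → 𝟙 (⌊ act N g x ≟ a ⌋ ∧ ⌊ act N g y ≟ b ⌋ ∧ p))

  regular-neighbours : ∀ {t t₋ t₊ w₋ w₊ w} → orbitSize N t ≡ 2 * N →
    orbitSum t w₋ + orbitSum t w₊ ≡ orbitSum t₋ w + orbitSum t₊ w →
    𝟙 (inOrbit N t w₋) + 𝟙 (inOrbit N t w₊)
      ≡ (2 * N) div orbitSize N t₋ * 𝟙 (inOrbit N t₋ w) + (2 * N) div orbitSize N t₊ * 𝟙 (inOrbit N t₊ w)
  regular-neighbours {t} {t₋} {t₊} {w₋} {w₊} {w} regular shift = begin
    𝟙 (inOrbit N t w₋) + 𝟙 (inOrbit N t w₊)
      ≡⟨ cong₂ _+_ (regular⇒χ≡orbitSum regular w₋) (regular⇒χ≡orbitSum regular w₊) ⟩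
    orbitSum t w₋ + orbitSum t w₊
      ≡⟨ shift ⟩
    orbitSum t₋ w + orbitSum t₊ w
      ≡⟨ cong₂ _+_ (orbitSum≡div*χ t₋ w) (orbitSum≡div*χ t₊ w) ⟩
    (2 * N) div orbitSize N t₋ * 𝟙 (inOrbit N t₋ w) + (2 * N) div orbitSize N t₊ * 𝟙 (inOrbit N t₊ w) ∎

lemma7p6 : (D : ℕ) → 2 ≤ D → (N : ℕ) → .{{_ : NonZero N}} → (N ≡ 2 * D ⊎ N ≡ 2 * D + 1) →
  (x y : Fin N) → inO N D x y → orbitSize N (x , y , zero' N) ≡ 2 * N →
  (∀ a b c → A⁽¹⁾ N (χ N (x , y , zero' N)) a b c
      ≡ lin2 N ((2 * N) div orbitSize N (pred' N x , y , zero' N)) (χ N (pred' N x , y , zero' N))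
               ((2 * N) div orbitSize N (suc' N x , y , zero' N)) (χ N (suc' N x , y , zero' N)) a b c)
  × (∀ a b c → A⁽²⁾ N (χ N (x , y , zero' N)) a b c
      ≡ lin2 N ((2 * N) div orbitSize N (x , pred' N y , zero' N)) (χ N (x , pred' N y , zero' N))
               ((2 * N) div orbitSize N (x , suc' N y , zero' N)) (χ N (x , suc' N y , zero' N)) a b c)
  × (∀ a b c → A⁽³⁾ N (χ N (x , y , zero' N)) a b c
      ≡ lin2 N ((2 * N) div orbitSize N (x , y , last' N)) (χ N (x , y , last' N))
               ((2 * N) div orbitSize N (x , y , one' N)) (χ N (x , y , one' N)) a b c)
lemma7p6 D _ N _ x y _ regular =
    (λ a b c → regular-neighbours N regular (A⁽¹⁾-orbitSum N x y (zero' N) a b c))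
  , (λ a b c → regular-neighbours N regular (A⁽²⁾-orbitSum N x y (zero' N) a b c))
  , (λ a b c → regular-neighbours N regular (A⁽³⁾-orbitSum-zero' a b c))
  where
  A⁽³⁾-orbitSum-zero' : ∀ a b c →
    orbitSum N (x , y , zero' N) (a , b , pred' N c) + orbitSum N (x , y , zero' N) (a , b , suc' N c)
      ≡ orbitSum N (x , y , last' N) (a , b , c) + orbitSum N (x , y , one' N) (a , b , c)
  A⁽³⁾-orbitSum-zero' a b c rewrite sym (pred'-zero' N) | sym (suc'-zero' N) =
    A⁽³⁾-orbitSum N x y (zero' N) a b c
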